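{- (1) Each of the relations $\to_{\beta_c}$, $\to_{\mathsf{id}}$, $\to_{\sigma}$ is confluent. (2) $\to_{\beta_c}\cup\to_{\mathsf{id}}$ and $\to_{\beta_c}\cup\to_{\sigma}$ are confluent. (3) $\to_{\beta_c}\cup\to_{\sigma}\cup\to_{\mathsf{id}}$ is confluent. (4) $\to_{\sigma}\cup\to_{\mathsf{id}}$ is not confluent.
   Context: The computational core $\lambda_{\copyright}$ has values $V,W ::= x \mid \lambda x.M$ and computations $M,N,L ::= \,!V \mid VM$ ($x$ ranging over a countable set of variables, terms up to $\alpha$-renaming). Rules on computations: $\beta_c$: $(\lambda x.M)(!V) \mapsto M\{V/x\}$; $\mathsf{id}$: $(\lambda x.!x)M \mapsto M$; $\sigma$: $(\lambda y.N)((\lambda x.M)L) \mapsto (\lambda x.(\lambda y.N)M)L$ provided $x\notin \mathrm{fv}(N)$. Contexts: $C ::= [\,] \mid\, !(\lambda x.C) \mid VC \mid (\lambda x.C)M$; $\to_\rho$ is the closure of rule $\rho$ under contexts. A relation $\to$ is confluent if whenever $M\to^* N_1$ and $M\to^* N_2$ there is $P$ with $N_1\to^*P$ and $N_2\to^*P$. -}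

module Defs where

-- The computational core λ©, terms in de Bruijn notation (so terms are
-- automatically identified up to α-renaming).

open import Data.Nat using (ℕ; zero; suc)
open import Data.Sum using (_⊎_)
open import Data.Product using (∃; _×_)
open import Relation.Binary.Construct.Closure.ReflexiveTransitive using (Star)

mutual
  data Val : Set where
    var : ℕ → Val
    lam : Comp → Val

  data Comp : Set where
    ret : Val → Comp          -- !V
    app : Val → Comp → Comp

ext : (ℕ → ℕ) → ℕ → ℕ
ext ρ zero    = zero
ext ρ (suc n) = suc (ρ n)

mutual
  renV : (ℕ → ℕ) → Val → Val
  renV ρ (var n) = var (ρ n)
  renV ρ (lam M) = lam (renC (ext ρ) M)

  renC : (ℕ → ℕ) → Comp → Comp
  renC ρ (ret V)   = ret (renV ρ V)
  renC ρ (app V M) = app (renV ρ V) (renC ρ M)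

exts : (ℕ → Val) → ℕ → Val
exts s zero    = var zero
exts s (suc n) = renV suc (s n)

mutual
  subV : (ℕ → Val) → Val → Val
  subV s (var n) = s n
  subV s (lam M) = lam (subC (exts s) M)

  subC : (ℕ → Val) → Comp → Comp
  subC s (ret V)   = ret (subV s V)
  subC s (app V M) = app (subV s V) (subC s M)

-- single substitution M{V/x} for the outermost bound variable x (index 0)
sub0 : Val → ℕ → Val
sub0 V zero    = V
sub0 V (suc n) = var n

_[_] : Comp → Val → Comp
M [ V ] = subC (sub0 V) M

Rel : Set₁
Rel = Comp → Comp → Set

data βc-root : Rel where
  βc : ∀ M V → βc-root (app (lam M) (ret V)) (M [ V ])

data id-root : Rel where
  idr : ∀ M → id-root (app (lam (ret (var zero))) M) M

-- σ : (λy.N)((λx.M)L) ↦ (λx.(λy.N)M)L   (x ∉ fv(N))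
-- In de Bruijn form, N (under binder y) is weakened past the new binder x:
-- its free variables (indices ≥ 1) are shifted by one.
data σ-root : Rel where
  σr : ∀ N M L →
       σ-root (app (lam N) (app (lam M) L))
              (app (lam (app (lam (renC (ext suc) N)) M)) L)

data Ctx (R : Rel) : Rel where
  root   : ∀ {M N} → R M N → Ctx R M N
  ret-λ  : ∀ {M N} → Ctx R M N → Ctx R (ret (lam M)) (ret (lam N))
  app-r  : ∀ {V M N} → Ctx R M N → Ctx R (app V M) (app V N)
  app-λ  : ∀ {M N L} → Ctx R M N → Ctx R (app (lam M) L) (app (lam N) L)

→βc →id →σ : Rel
→βc = Ctx βc-root
→id = Ctx id-root
→σ  = Ctx σ-root

-- union of reduction relations (the closure of a union of rules coincides
-- with the union of the closures; we take the union of the step relations)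
_∪→_ : Rel → Rel → Rel
(R ∪→ S) M N = R M N ⊎ S M N

Confluent : Rel → Set
Confluent R = ∀ {M N₁ N₂} → Star R M N₁ → Star R M N₂ →
              ∃ λ P → Star R N₁ P × Star R N₂ P

-- βc is confluent by the Tait–Martin-Löf method: its parallel reduction has
-- the triangle property w.r.t. the complete development. The rules id and σ
-- are the unit and associativity laws of the monad bind (λx.N) M; each has a
-- computable normal form that every step preserves. The unions follow by
-- Hindley–Rosen from strong commutation diagrams, where only root overlaps
-- need real work; for σ ∪ id one of these, (λy.N)((λx.!x)L), can only be
-- closed by a βc step, which is why σ ∪ id alone is not confluent:
-- (λy.!z)((λx.!x)!z) reduces to two distinct σ∪id-normal forms.

module Submission where

open import Data.Nat using (ℕ; zero; suc)
open import Data.Product using (∃; _×_; _,_; -,_)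
open import Data.Sum using (inj₁; inj₂; [_,_])
open import Function using (_∘_; id)
open import Level using (Level)
open import Relation.Binary.Core using (_⇒_)
import Relation.Binary.Construct.Closure.Reflexive as Refl
open Refl using (ReflClosure)
open import Relation.Binary.Construct.Closure.ReflexiveTransitive
  using (Star; ε; _◅_; _◅◅_; gmap; fold; return; _⋆)
open import Relation.Binary.Construct.Closure.Equivalence.Properties
  using (a—↠b&a—↠c⇒b↔c)
open import Relation.Binary.Construct.Union using (_∪_)
open import Relation.Binary.PropositionalEquality
  using (_≡_; refl; sym; trans; cong; cong₂; subst; subst₂; _≗_)
import Relation.Binary.Rewriting as Rewriting
open import Relation.Nullary using (¬_)

open import Defs

-- Rewriting.Confluent R unfolds to Confluent R of Defs, so these lemmas apply there directly.
module _ {ℓ : Level} {A : Set ℓ} where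

  Diamond : (A → A → Set ℓ) → Set _
  Diamond R = ∀ {M N₁ N₂} → R M N₁ → R M N₂ → ∃ λ P → R N₁ P × R N₂ P

  Diagram : (R S T : A → A → Set ℓ) → Set _
  Diagram R S T = ∀ {M N₁ N₂} → R M N₁ → S M N₂ →
                  ∃ λ P → Star S N₁ P × ReflClosure T N₂ P

  StronglyCommute : (R S : A → A → Set ℓ) → Set _
  StronglyCommute R S = Diagram R S R

  Commute : (R S : A → A → Set ℓ) → Set _
  Commute R S = ∀ {M N₁ N₂} → Star R M N₁ → Star S M N₂ →
                ∃ λ P → Star S N₁ P × Star R N₂ P

  private variable R R′ S T T′ : A → A → Set ℓ

  Diagram-weaken : T ⇒ T′ → Diagram R S T → Diagram R S T′
  Diagram-weaken T⇒T′ d r s = let P , ss , t = d r s in P , ss , Refl.map T⇒T′ t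

  Diagram-∪ : Diagram R S T → Diagram R′ S T → Diagram (R ∪ R′) S T
  Diagram-∪ d d′ = [ d , d′ ]

  ∪-swapʳ : (R ∪ S) ∪ T ⇒ (R ∪ T) ∪ S
  ∪-swapʳ = [ [ inj₁ ∘ inj₁ , inj₂ ] , inj₁ ∘ inj₂ ]

  ReflClosure⇒Star : ReflClosure R ⇒ Star R
  ReflClosure⇒Star Refl.refl    = ε
  ReflClosure⇒Star Refl.[ r ] = return r

  strongly-commute-strip : StronglyCommute R S → ∀ {M N₁ N₂} → R M N₁ → Star S M N₂ →
                           ∃ λ P → Star S N₁ P × ReflClosure R N₂ P
  strongly-commute-strip sc r ε = -, ε , Refl.[ r ]
  strongly-commute-strip sc r (s ◅ ss) with sc r s
  ... | _ , ss₁ , Refl.refl  = -, ss₁ ◅◅ ss , Refl.refl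
  ... | _ , ss₁ , Refl.[ r′ ] =
    let P , ss₂ , r″ = strongly-commute-strip sc r′ ss in P , ss₁ ◅◅ ss₂ , r″

  strongly-commute⇒commute : StronglyCommute R S → Commute R S
  strongly-commute⇒commute sc ε ss = -, ss , ε
  strongly-commute⇒commute sc (r ◅ rs) ss =
    let _ , ss₁ , r′  = strongly-commute-strip sc r ss
        P , ss₂ , rs′ = strongly-commute⇒commute sc rs ss₁
    in P , ss₂ , ReflClosure⇒Star r′ ◅◅ rs′

  diamond⇒confluent : Diamond R → Rewriting.Confluent R
  diamond⇒confluent d = strongly-commute⇒commute λ r₁ r₂ →
    let P , r₁′ , r₂′ = d r₁ r₂ in P , return r₁′ , Refl.[ r₂′ ]

  confluent-transfer : R ⇒ Star S → S ⇒ Star R → Rewriting.Confluent S → Rewriting.Confluent R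
  confluent-transfer R⇒S* S⇒R* conf r₁ r₂ =
    let P , s₁ , s₂ = conf ((R⇒S* ⋆) r₁) ((R⇒S* ⋆) r₂) in P , (S⇒R* ⋆) s₁ , (S⇒R* ⋆) s₂

  triangle⇒confluent : (dev : A → A) → R ⇒ S → S ⇒ Star R →
                       (∀ {M N} → S M N → S N (dev M)) → Rewriting.Confluent R
  triangle⇒confluent dev R⇒S S⇒R* triangle =
    confluent-transfer (return ∘ R⇒S) S⇒R* (diamond⇒confluent λ s₁ s₂ → -, triangle s₁ , triangle s₂)

  normaliser⇒confluent : (nf : A → A) → (∀ M → Star R M (nf M)) →
                         (∀ {M N} → R M N → nf M ≡ nf N) → Rewriting.Confluent R
  normaliser⇒confluent {R = R} nf reduces-to-nf nf-invariant {M} r₁ r₂ =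
    nf M , reduces-to-nf-of-source r₁ , reduces-to-nf-of-source r₂
    where
    reduces-to-nf-of-source : ∀ {N} → Star R M N → Star R N (nf M)
    reduces-to-nf-of-source {N} rs =
      subst (Star R N) (sym (fold (λ x y → nf x ≡ nf y) (trans ∘ nf-invariant) refl rs))
            (reduces-to-nf N)

  hindley-rosen : Rewriting.Confluent R → Rewriting.Confluent S → Commute R S →
                  Rewriting.Confluent (R ∪ S)
  hindley-rosen {R = R} {S = S} conf-R conf-S comm =
    confluent-transfer (return ∘ [ inj₁ ∘ return , inj₂ ∘ return ])
                       [ gmap id inj₁ , gmap id inj₂ ]
                       (diamond⇒confluent diamond)
    where
    diamond : Diamond (Star R ∪ Star S)
    diamond (inj₁ r₁) (inj₁ r₂) = let P , u , v = conf-R r₁ r₂ in P , inj₁ u , inj₁ v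
    diamond (inj₂ s₁) (inj₂ s₂) = let P , u , v = conf-S s₁ s₂ in P , inj₂ u , inj₂ v
    diamond (inj₁ r)  (inj₂ s)  = let P , u , v = comm r s in P , inj₂ u , inj₁ v
    diamond (inj₂ s)  (inj₁ r)  = let P , u , v = comm r s in P , inj₁ v , inj₂ u

ext-cong : ∀ {ρ ρ′} → ρ ≗ ρ′ → ext ρ ≗ ext ρ′
ext-cong e zero    = refl
ext-cong e (suc n) = cong suc (e n)

exts-cong : ∀ {s s′} → s ≗ s′ → exts s ≗ exts s′
exts-cong e zero    = refl
exts-cong e (suc n) = cong (renV suc) (e n)

mutual
  renV-cong : ∀ {ρ ρ′} → ρ ≗ ρ′ → renV ρ ≗ renV ρ′
  renV-cong e (var n) = cong var (e n)
  renV-cong e (lam M) = cong lam (renC-cong (ext-cong e) M)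

  renC-cong : ∀ {ρ ρ′} → ρ ≗ ρ′ → renC ρ ≗ renC ρ′
  renC-cong e (ret V)   = cong ret (renV-cong e V)
  renC-cong e (app V M) = cong₂ app (renV-cong e V) (renC-cong e M)

mutual
  subV-cong : ∀ {s s′} → s ≗ s′ → subV s ≗ subV s′
  subV-cong e (var n) = e n
  subV-cong e (lam M) = cong lam (subC-cong (exts-cong e) M)

  subC-cong : ∀ {s s′} → s ≗ s′ → subC s ≗ subC s′
  subC-cong e (ret V)   = cong ret (subV-cong e V)
  subC-cong e (app V M) = cong₂ app (subV-cong e V) (subC-cong e M)

mutual
  renV-∘ : ∀ ρ ρ′ V → renV ρ (renV ρ′ V) ≡ renV (ρ ∘ ρ′) V
  renV-∘ ρ ρ′ (var n) = refl
  renV-∘ ρ ρ′ (lam M) = cong lam (trans (renC-∘ (ext ρ) (ext ρ′) M) (renC-cong ext-∘ M))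
    where
    ext-∘ : ext ρ ∘ ext ρ′ ≗ ext (ρ ∘ ρ′)
    ext-∘ zero    = refl
    ext-∘ (suc n) = refl

  renC-∘ : ∀ ρ ρ′ M → renC ρ (renC ρ′ M) ≡ renC (ρ ∘ ρ′) M
  renC-∘ ρ ρ′ (ret V)   = cong ret (renV-∘ ρ ρ′ V)
  renC-∘ ρ ρ′ (app V M) = cong₂ app (renV-∘ ρ ρ′ V) (renC-∘ ρ ρ′ M)

mutual
  subV-renV : ∀ s ρ V → subV s (renV ρ V) ≡ subV (s ∘ ρ) V
  subV-renV s ρ (var n) = refl
  subV-renV s ρ (lam M) = cong lam (trans (subC-renC (exts s) (ext ρ) M) (subC-cong exts-ext M))
    where
    exts-ext : exts s ∘ ext ρ ≗ exts (s ∘ ρ)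
    exts-ext zero    = refl
    exts-ext (suc n) = refl

  subC-renC : ∀ s ρ M → subC s (renC ρ M) ≡ subC (s ∘ ρ) M
  subC-renC s ρ (ret V)   = cong ret (subV-renV s ρ V)
  subC-renC s ρ (app V M) = cong₂ app (subV-renV s ρ V) (subC-renC s ρ M)

mutual
  renV-subV : ∀ ρ s V → renV ρ (subV s V) ≡ subV (renV ρ ∘ s) V
  renV-subV ρ s (var n) = refl
  renV-subV ρ s (lam M) = cong lam (trans (renC-subC (ext ρ) (exts s) M) (subC-cong ext-exts M))
    where
    ext-exts : renV (ext ρ) ∘ exts s ≗ exts (renV ρ ∘ s)
    ext-exts zero    = refl
    ext-exts (suc n) = trans (renV-∘ (ext ρ) suc (s n)) (sym (renV-∘ suc ρ (s n)))

  renC-subC : ∀ ρ s M → renC ρ (subC s M) ≡ subC (renV ρ ∘ s) M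
  renC-subC ρ s (ret V)   = cong ret (renV-subV ρ s V)
  renC-subC ρ s (app V M) = cong₂ app (renV-subV ρ s V) (renC-subC ρ s M)

mutual
  subV-∘ : ∀ s t V → subV s (subV t V) ≡ subV (subV s ∘ t) V
  subV-∘ s t (var n) = refl
  subV-∘ s t (lam M) = cong lam (trans (subC-∘ (exts s) (exts t) M) (subC-cong exts-∘ M))
    where
    exts-∘ : subV (exts s) ∘ exts t ≗ exts (subV s ∘ t)
    exts-∘ zero    = refl
    exts-∘ (suc n) = trans (subV-renV (exts s) suc (t n)) (sym (renV-subV suc s (t n)))

  subC-∘ : ∀ s t M → subC s (subC t M) ≡ subC (subV s ∘ t) M
  subC-∘ s t (ret V)   = cong ret (subV-∘ s t V)
  subC-∘ s t (app V M) = cong₂ app (subV-∘ s t V) (subC-∘ s t M)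

mutual
  subV-var : ∀ {s} → s ≗ var → subV s ≗ id
  subV-var e (var n) = e n
  subV-var e (lam M) = cong lam (subC-var (exts-var e) M)
    where
    exts-var : ∀ {s} → s ≗ var → exts s ≗ var
    exts-var e zero    = refl
    exts-var e (suc n) = cong (renV suc) (e n)

  subC-var : ∀ {s} → s ≗ var → subC s ≗ id
  subC-var e (ret V)   = cong ret (subV-var e V)
  subC-var e (app V M) = cong₂ app (subV-var e V) (subC-var e M)

mutual
  renV≡subV : ∀ ρ → renV ρ ≗ subV (var ∘ ρ)
  renV≡subV ρ (var n) = refl
  renV≡subV ρ (lam M) = cong lam (trans (renC≡subC (ext ρ) M) (subC-cong var-ext M))
    where
    var-ext : var ∘ ext ρ ≗ exts (var ∘ ρ)
    var-ext zero    = refl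
    var-ext (suc n) = refl

  renC≡subC : ∀ ρ → renC ρ ≗ subC (var ∘ ρ)
  renC≡subC ρ (ret V)   = cong ret (renV≡subV ρ V)
  renC≡subC ρ (app V M) = cong₂ app (renV≡subV ρ V) (renC≡subC ρ M)

renC-[] : ∀ ρ V M → renC ρ (M [ V ]) ≡ renC (ext ρ) M [ renV ρ V ]
renC-[] ρ V M = trans (renC-subC ρ (sub0 V) M)
  (trans (subC-cong ren-sub0 M) (sym (subC-renC (sub0 (renV ρ V)) (ext ρ) M)))
  where
  ren-sub0 : renV ρ ∘ sub0 V ≗ sub0 (renV ρ V) ∘ ext ρ
  ren-sub0 zero    = refl
  ren-sub0 (suc n) = refl

subC-[] : ∀ s V M → subC s (M [ V ]) ≡ subC (exts s) M [ subV s V ]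
subC-[] s V M = trans (subC-∘ s (sub0 V) M)
  (trans (subC-cong sub-sub0 M) (sym (subC-∘ (sub0 (subV s V)) (exts s) M)))
  where
  sub-sub0 : subV s ∘ sub0 V ≗ subV (sub0 (subV s V)) ∘ exts s
  sub-sub0 zero    = refl
  sub-sub0 (suc n) = sym (trans (subV-renV (sub0 (subV s V)) suc (s n)) (subV-var (λ _ → refl) (s n)))

renC-square : ∀ {ρ₁ ρ₂ ρ₃ ρ₄} → ρ₁ ∘ ρ₂ ≗ ρ₃ ∘ ρ₄ → ∀ M → renC ρ₁ (renC ρ₂ M) ≡ renC ρ₃ (renC ρ₄ M)
renC-square {ρ₁} {ρ₂} {ρ₃} {ρ₄} e M =
  trans (renC-∘ ρ₁ ρ₂ M) (trans (renC-cong e M) (sym (renC-∘ ρ₃ ρ₄ M)))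

wk : Comp → Comp
wk = renC (ext suc)

subC-wk : ∀ {s} → s ∘ ext suc ≗ var → ∀ N → subC s (wk N) ≡ N
subC-wk {s} e N = trans (subC-renC s (ext suc) N) (subC-var e N)

wk-subC : ∀ s N → wk (subC (exts s) N) ≡ subC (exts (exts s)) (wk N)
wk-subC s N = trans (renC-subC (ext suc) (exts s) N) (trans (subC-cong wk-exts N) (sym (subC-renC _ _ N)))
  where
  wk-exts : renV (ext suc) ∘ exts s ≗ exts (exts s) ∘ ext suc
  wk-exts zero    = refl
  wk-exts (suc n) = trans (renV-∘ (ext suc) suc (s n)) (sym (renV-∘ suc suc (s n)))

module _ {r : Rel} where

  ret-λ* : ∀ {M N} → Star (Ctx r) M N → Star (Ctx r) (ret (lam M)) (ret (lam N))
  ret-λ* = gmap _ ret-λ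

  app-r* : ∀ {V M N} → Star (Ctx r) M N → Star (Ctx r) (app V M) (app V N)
  app-r* = gmap _ app-r

  app-λ* : ∀ {L M N} → Star (Ctx r) M N → Star (Ctx r) (app (lam M) L) (app (lam N) L)
  app-λ* = gmap _ app-λ

Ctx-map : ∀ {r s} → r ⇒ s → Ctx r ⇒ Ctx s
Ctx-map r⇒s (root x)  = root (r⇒s x)
Ctx-map r⇒s (ret-λ x) = ret-λ (Ctx-map r⇒s x)
Ctx-map r⇒s (app-r x) = app-r (Ctx-map r⇒s x)
Ctx-map r⇒s (app-λ x) = app-λ (Ctx-map r⇒s x)

Ctx-∪ : ∀ {r s} → Ctx (r ∪ s) ⇒ Ctx r ∪ Ctx s
Ctx-∪ (root (inj₁ x)) = inj₁ (root x)
Ctx-∪ (root (inj₂ x)) = inj₂ (root x)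
Ctx-∪ (ret-λ x) = [ inj₁ ∘ ret-λ , inj₂ ∘ ret-λ ] (Ctx-∪ x)
Ctx-∪ (app-r x) = [ inj₁ ∘ app-r , inj₂ ∘ app-r ] (Ctx-∪ x)
Ctx-∪ (app-λ x) = [ inj₁ ∘ app-λ , inj₂ ∘ app-λ ] (Ctx-∪ x)

SubstStable : Rel → Set
SubstStable r = ∀ s {M N} → r M N → r (subC s M) (subC s N)

module _ {r : Rel} (stable : SubstStable r) where

  Ctx-subst : ∀ s {M N} → Ctx r M N → Ctx r (subC s M) (subC s N)
  Ctx-subst s (root x)  = root (stable s x)
  Ctx-subst s (ret-λ x) = ret-λ (Ctx-subst (exts s) x)
  Ctx-subst s (app-r x) = app-r (Ctx-subst s x)
  Ctx-subst s (app-λ x) = app-λ (Ctx-subst (exts s) x)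

  Ctx-rename : ∀ ρ {M N} → Ctx r M N → Ctx r (renC ρ M) (renC ρ N)
  Ctx-rename ρ {M} {N} x = subst₂ (Ctx r) (sym (renC≡subC ρ M)) (sym (renC≡subC ρ N)) (Ctx-subst (var ∘ ρ) x)

  Star-rename : ∀ ρ {M N} → Star (Ctx r) M N → Star (Ctx r) (renC ρ M) (renC ρ N)
  Star-rename ρ = gmap _ (Ctx-rename ρ)

  data _↠ᵥ_ : Val → Val → Set where
    same : ∀ {V} → V ↠ᵥ V
    lam* : ∀ {Q Q′} → Star (Ctx r) Q Q′ → lam Q ↠ᵥ lam Q′

  ↠ᵥ-rename : ∀ ρ {V V′} → V ↠ᵥ V′ → renV ρ V ↠ᵥ renV ρ V′
  ↠ᵥ-rename ρ same     = same
  ↠ᵥ-rename ρ (lam* x) = lam* (Star-rename (ext ρ) x)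

  ret-↠ᵥ : ∀ {V V′} → V ↠ᵥ V′ → Star (Ctx r) (ret V) (ret V′)
  ret-↠ᵥ same     = ε
  ret-↠ᵥ (lam* x) = ret-λ* x

  app-↠ᵥ : ∀ {V V′} L → V ↠ᵥ V′ → Star (Ctx r) (app V L) (app V′ L)
  app-↠ᵥ L same     = ε
  app-↠ᵥ L (lam* x) = app-λ* x

  _↠ˢ_ : (ℕ → Val) → (ℕ → Val) → Set
  s ↠ˢ s′ = ∀ n → s n ↠ᵥ s′ n

  ↠ˢ-exts : ∀ {s s′} → s ↠ˢ s′ → exts s ↠ˢ exts s′
  ↠ˢ-exts h zero    = same
  ↠ˢ-exts h (suc n) = ↠ᵥ-rename suc (h n)

  mutual
    subC-↠ˢ : ∀ {s s′} → s ↠ˢ s′ → ∀ M → Star (Ctx r) (subC s M) (subC s′ M)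
    subC-↠ˢ h (ret (var n)) = ret-↠ᵥ (h n)
    subC-↠ˢ h (ret (lam M)) = ret-λ* (subC-↠ˢ (↠ˢ-exts h) M)
    subC-↠ˢ {s} h (app V M) = app-subV-↠ˢ h V (subC s M) ◅◅ app-r* (subC-↠ˢ h M)

    app-subV-↠ˢ : ∀ {s s′} → s ↠ˢ s′ → ∀ V L → Star (Ctx r) (app (subV s V) L) (app (subV s′ V) L)
    app-subV-↠ˢ h (var n) L = app-↠ᵥ L (h n)
    app-subV-↠ˢ h (lam M) L = app-λ* (subC-↠ˢ (↠ˢ-exts h) M)

  []-↠ : ∀ {Q Q′} → Star (Ctx r) Q Q′ → ∀ M → Star (Ctx r) (M [ lam Q ]) (M [ lam Q′ ])
  []-↠ xs = subC-↠ˢ sub0-↠ˢ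
    where
    sub0-↠ˢ : sub0 (lam _) ↠ˢ sub0 (lam _)
    sub0-↠ˢ zero    = lam* xs
    sub0-↠ˢ (suc n) = same

-- Steps in disjoint subterms commute and steps in a common subterm are handled inductively,
-- so only the diagrams with a root step are needed (root-right is used only below the root).
module _ {r s t : Rel} (r⇒t : r ⇒ t)
         (root-left : Diagram r (Ctx s) (Ctx t))
         (root-right : ∀ {M N₁ N₂} → Ctx r M N₁ → s M N₂ →
                       ∃ λ P → Star (Ctx s) N₁ P × ReflClosure (Ctx t) N₂ P)
         where

  Ctx-diagram : Diagram (Ctx r) (Ctx s) (Ctx t)
  Ctx-diagram (root x) y = root-left x y
  Ctx-diagram x (root y) = root-right x y
  Ctx-diagram (ret-λ x) (ret-λ y) = let _ , ys , x′ = Ctx-diagram x y in -, ret-λ* ys , Refl.map ret-λ x′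
  Ctx-diagram (app-r x) (app-r y) = let _ , ys , x′ = Ctx-diagram x y in -, app-r* ys , Refl.map app-r x′
  Ctx-diagram (app-λ x) (app-λ y) = let _ , ys , x′ = Ctx-diagram x y in -, app-λ* ys , Refl.map app-λ x′
  Ctx-diagram (app-r x) (app-λ y) = -, return (app-λ y) , Refl.[ app-r (Ctx-map r⇒t x) ]
  Ctx-diagram (app-λ x) (app-r y) = -, return (app-r y) , Refl.[ app-λ (Ctx-map r⇒t x) ]

bind-id : Comp → Comp → Comp
bind-id M (ret (var zero))    = M
bind-id M (ret (var (suc n))) = app (lam (ret (var (suc n)))) M
bind-id M (ret (lam N))       = app (lam (ret (lam N))) M
bind-id M (app V N)           = app (lam (app V N)) M

bind-id-reduces : ∀ M N → Star →id (app (lam N) M) (bind-id M N)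
bind-id-reduces M (ret (var zero))    = return (root (idr M))
bind-id-reduces M (ret (var (suc n))) = ε
bind-id-reduces M (ret (lam N))       = ε
bind-id-reduces M (app V N)           = ε

mutual
  nfV-id : Val → Val
  nfV-id (var n) = var n
  nfV-id (lam M) = lam (nf-id M)

  nf-id : Comp → Comp
  nf-id (ret V)         = ret (nfV-id V)
  nf-id (app (var n) M) = app (var n) (nf-id M)
  nf-id (app (lam N) M) = bind-id (nf-id M) (nf-id N)

reduces-to-nf-id : ∀ M → Star →id M (nf-id M)
reduces-to-nf-id (ret (var n))   = ε
reduces-to-nf-id (ret (lam M))   = ret-λ* (reduces-to-nf-id M)
reduces-to-nf-id (app (var n) M) = app-r* (reduces-to-nf-id M)
reduces-to-nf-id (app (lam N) M) =
  app-λ* (reduces-to-nf-id N) ◅◅ app-r* (reduces-to-nf-id M) ◅◅ bind-id-reduces (nf-id M) (nf-id N)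

nf-id-invariant : ∀ {M N} → →id M N → nf-id M ≡ nf-id N
nf-id-invariant (root (idr _))    = refl
nf-id-invariant (ret-λ x)         = cong (ret ∘ lam) (nf-id-invariant x)
nf-id-invariant (app-r {var n} x) = cong (app (var n)) (nf-id-invariant x)
nf-id-invariant (app-r {lam N} x) = cong (λ M → bind-id M (nf-id N)) (nf-id-invariant x)
nf-id-invariant (app-λ {L = L} x) = cong (bind-id (nf-id L)) (nf-id-invariant x)

confluent-id : Confluent →id
confluent-id = normaliser⇒confluent nf-id reduces-to-nf-id nf-id-invariant

-- σ-normal forms are right-nested lets; bind-σ M N appends N at the end of the let-chain M.
bind-σ : Comp → Comp → Comp
bind-σ (ret V)         N = app (lam N) (ret V)
bind-σ (app (var n) L) N = app (lam N) (app (var n) L)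
bind-σ (app (lam M) L) N = app (lam (bind-σ M (wk N))) L

bind-σ-reduces : ∀ M N → Star →σ (app (lam N) M) (bind-σ M N)
bind-σ-reduces (ret V)         N = ε
bind-σ-reduces (app (var n) L) N = ε
bind-σ-reduces (app (lam M) L) N = root (σr N M L) ◅ app-λ* (bind-σ-reduces M (wk N))

renC-bind-σ : ∀ ρ M N → renC ρ (bind-σ M N) ≡ bind-σ (renC ρ M) (renC (ext ρ) N)
renC-bind-σ ρ (ret V)         N = refl
renC-bind-σ ρ (app (var n) L) N = refl
renC-bind-σ ρ (app (lam M) L) N = cong (λ B → app (lam B) (renC ρ L))
  (trans (renC-bind-σ (ext ρ) M (wk N)) (cong (bind-σ (renC (ext ρ) M)) (renC-square ext-ext-wk N)))
  where
  ext-ext-wk : ext (ext ρ) ∘ ext suc ≗ ext suc ∘ ext ρ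
  ext-ext-wk zero    = refl
  ext-ext-wk (suc n) = refl

bind-σ-assoc : ∀ L M N → bind-σ (bind-σ L M) N ≡ bind-σ L (bind-σ M (wk N))
bind-σ-assoc (ret V)         M N = refl
bind-σ-assoc (app (var n) L) M N = refl
bind-σ-assoc (app (lam K) L) M N = cong (λ B → app (lam B) L)
  (trans (bind-σ-assoc K (wk M) (wk N))
         (cong (bind-σ K) (trans (cong (bind-σ (wk M)) (renC-square wk-wk N))
                                 (sym (renC-bind-σ (ext suc) M (wk N))))))
  where
  wk-wk : ext suc ∘ ext suc ≗ ext (ext suc) ∘ ext suc
  wk-wk zero    = refl
  wk-wk (suc n) = refl

mutual
  nfV-σ : Val → Val
  nfV-σ (var n) = var n
  nfV-σ (lam M) = lam (nf-σ M)

  nf-σ : Comp → Comp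
  nf-σ (ret V)         = ret (nfV-σ V)
  nf-σ (app (var n) M) = app (var n) (nf-σ M)
  nf-σ (app (lam N) M) = bind-σ (nf-σ M) (nf-σ N)

mutual
  nfV-σ-renV : ∀ ρ V → nfV-σ (renV ρ V) ≡ renV ρ (nfV-σ V)
  nfV-σ-renV ρ (var n) = refl
  nfV-σ-renV ρ (lam M) = cong lam (nf-σ-renC (ext ρ) M)

  nf-σ-renC : ∀ ρ M → nf-σ (renC ρ M) ≡ renC ρ (nf-σ M)
  nf-σ-renC ρ (ret V)         = cong ret (nfV-σ-renV ρ V)
  nf-σ-renC ρ (app (var n) M) = cong (app (var (ρ n))) (nf-σ-renC ρ M)
  nf-σ-renC ρ (app (lam N) M) =
    trans (cong₂ bind-σ (nf-σ-renC ρ M) (nf-σ-renC (ext ρ) N)) (sym (renC-bind-σ ρ (nf-σ M) (nf-σ N)))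

reduces-to-nf-σ : ∀ M → Star →σ M (nf-σ M)
reduces-to-nf-σ (ret (var n))   = ε
reduces-to-nf-σ (ret (lam M))   = ret-λ* (reduces-to-nf-σ M)
reduces-to-nf-σ (app (var n) M) = app-r* (reduces-to-nf-σ M)
reduces-to-nf-σ (app (lam N) M) =
  app-λ* (reduces-to-nf-σ N) ◅◅ app-r* (reduces-to-nf-σ M) ◅◅ bind-σ-reduces (nf-σ M) (nf-σ N)

nf-σ-invariant : ∀ {M N} → →σ M N → nf-σ M ≡ nf-σ N
nf-σ-invariant (root (σr N M L)) =
  trans (bind-σ-assoc (nf-σ L) (nf-σ M) (nf-σ N))
        (cong (bind-σ (nf-σ L) ∘ bind-σ (nf-σ M)) (sym (nf-σ-renC (ext suc) N)))
nf-σ-invariant (ret-λ x)         = cong (ret ∘ lam) (nf-σ-invariant x)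
nf-σ-invariant (app-r {var n} x) = cong (app (var n)) (nf-σ-invariant x)
nf-σ-invariant (app-r {lam N} x) = cong (λ M → bind-σ M (nf-σ N)) (nf-σ-invariant x)
nf-σ-invariant (app-λ {L = L} x) = cong (bind-σ (nf-σ L)) (nf-σ-invariant x)

confluent-σ : Confluent →σ
confluent-σ = normaliser⇒confluent nf-σ reduces-to-nf-σ nf-σ-invariant

infix 4 _⇛ᵥ_ _⇛_

mutual
  data _⇛ᵥ_ : Val → Val → Set where
    ⇛-var : ∀ {n} → var n ⇛ᵥ var n
    ⇛-lam : ∀ {M M′} → M ⇛ M′ → lam M ⇛ᵥ lam M′

  data _⇛_ : Comp → Comp → Set where
    ⇛-ret : ∀ {V V′} → V ⇛ᵥ V′ → ret V ⇛ ret V′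
    ⇛-app : ∀ {V V′ M M′} → V ⇛ᵥ V′ → M ⇛ M′ → app V M ⇛ app V′ M′
    ⇛-βc  : ∀ {M M′ V V′} → M ⇛ M′ → V ⇛ᵥ V′ → app (lam M) (ret V) ⇛ M′ [ V′ ]

mutual
  ⇛ᵥ-refl : ∀ V → V ⇛ᵥ V
  ⇛ᵥ-refl (var n) = ⇛-var
  ⇛ᵥ-refl (lam M) = ⇛-lam (⇛-refl M)

  ⇛-refl : ∀ M → M ⇛ M
  ⇛-refl (ret V)   = ⇛-ret (⇛ᵥ-refl V)
  ⇛-refl (app V M) = ⇛-app (⇛ᵥ-refl V) (⇛-refl M)

mutual
  ⇛ᵥ-rename : ∀ ρ {V V′} → V ⇛ᵥ V′ → renV ρ V ⇛ᵥ renV ρ V′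
  ⇛ᵥ-rename ρ ⇛-var     = ⇛-var
  ⇛ᵥ-rename ρ (⇛-lam p) = ⇛-lam (⇛-rename (ext ρ) p)

  ⇛-rename : ∀ ρ {M M′} → M ⇛ M′ → renC ρ M ⇛ renC ρ M′
  ⇛-rename ρ (⇛-ret v)   = ⇛-ret (⇛ᵥ-rename ρ v)
  ⇛-rename ρ (⇛-app v p) = ⇛-app (⇛ᵥ-rename ρ v) (⇛-rename ρ p)
  ⇛-rename ρ (⇛-βc {M′ = M′} {V′ = V′} p v) =
    subst (_ ⇛_) (sym (renC-[] ρ V′ M′)) (⇛-βc (⇛-rename (ext ρ) p) (⇛ᵥ-rename ρ v))

_⇛ˢ_ : (ℕ → Val) → (ℕ → Val) → Set
s ⇛ˢ s′ = ∀ n → s n ⇛ᵥ s′ n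

⇛ˢ-exts : ∀ {s s′} → s ⇛ˢ s′ → exts s ⇛ˢ exts s′
⇛ˢ-exts ps zero    = ⇛-var
⇛ˢ-exts ps (suc n) = ⇛ᵥ-rename suc (ps n)

mutual
  ⇛ᵥ-subst : ∀ {s s′} → s ⇛ˢ s′ → ∀ {V V′} → V ⇛ᵥ V′ → subV s V ⇛ᵥ subV s′ V′
  ⇛ᵥ-subst ps (⇛-var {n}) = ps n
  ⇛ᵥ-subst ps (⇛-lam p)   = ⇛-lam (⇛-subst (⇛ˢ-exts ps) p)

  ⇛-subst : ∀ {s s′} → s ⇛ˢ s′ → ∀ {M M′} → M ⇛ M′ → subC s M ⇛ subC s′ M′
  ⇛-subst ps (⇛-ret v)   = ⇛-ret (⇛ᵥ-subst ps v)
  ⇛-subst ps (⇛-app v p) = ⇛-app (⇛ᵥ-subst ps v) (⇛-subst ps p)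
  ⇛-subst {s′ = s′} ps (⇛-βc {M′ = M′} {V′ = V′} p v) =
    subst (_ ⇛_) (sym (subC-[] s′ V′ M′)) (⇛-βc (⇛-subst (⇛ˢ-exts ps) p) (⇛ᵥ-subst ps v))

⇛-[] : ∀ {M M′ V V′} → M ⇛ M′ → V ⇛ᵥ V′ → M [ V ] ⇛ M′ [ V′ ]
⇛-[] p v = ⇛-subst sub0-⇛ˢ p
  where
  sub0-⇛ˢ : sub0 _ ⇛ˢ sub0 _
  sub0-⇛ˢ zero    = v
  sub0-⇛ˢ (suc n) = ⇛-var

mutual
  devV : Val → Val
  devV (var n) = var n
  devV (lam M) = lam (dev M)

  dev : Comp → Comp
  dev (ret V)                 = ret (devV V)
  dev (app (var n) M)         = app (var n) (dev M)
  dev (app (lam M) (ret V))   = dev M [ devV V ]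
  dev (app (lam M) (app W L)) = app (lam (dev M)) (dev (app W L))

mutual
  devV-triangle : ∀ {V W} → V ⇛ᵥ W → W ⇛ᵥ devV V
  devV-triangle ⇛-var     = ⇛-var
  devV-triangle (⇛-lam p) = ⇛-lam (dev-triangle p)

  dev-triangle : ∀ {M N} → M ⇛ N → N ⇛ dev M
  dev-triangle (⇛-ret v)   = ⇛-ret (devV-triangle v)
  dev-triangle (⇛-app v p) = dev-triangle-app v p
  dev-triangle (⇛-βc p v)  = ⇛-[] (dev-triangle p) (devV-triangle v)

  dev-triangle-app : ∀ {V V′ M M′} → V ⇛ᵥ V′ → M ⇛ M′ → app V′ M′ ⇛ dev (app V M)
  dev-triangle-app ⇛-var     p           = ⇛-app ⇛-var (dev-triangle p)
  dev-triangle-app (⇛-lam q) (⇛-ret v)   = ⇛-βc (dev-triangle q) (devV-triangle v)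
  dev-triangle-app (⇛-lam q) (⇛-app v p) = ⇛-app (⇛-lam (dev-triangle q)) (dev-triangle-app v p)
  dev-triangle-app (⇛-lam q) (⇛-βc p v)  = ⇛-app (⇛-lam (dev-triangle q)) (dev-triangle (⇛-βc p v))

→βc⇒⇛ : →βc ⇒ _⇛_
→βc⇒⇛ (root (βc M V))   = ⇛-βc (⇛-refl M) (⇛ᵥ-refl V)
→βc⇒⇛ (ret-λ x)         = ⇛-ret (⇛-lam (→βc⇒⇛ x))
→βc⇒⇛ (app-r {V} x)     = ⇛-app (⇛ᵥ-refl V) (→βc⇒⇛ x)
→βc⇒⇛ (app-λ {L = L} x) = ⇛-app (⇛-lam (→βc⇒⇛ x)) (⇛-refl L)

mutual
  ⇛⇒→βc* : _⇛_ ⇒ Star →βc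
  ⇛⇒→βc* (⇛-ret v)   = ret-⇛ᵥ v
  ⇛⇒→βc* (⇛-app v p) = app-⇛ᵥ v ◅◅ app-r* (⇛⇒→βc* p)
  ⇛⇒→βc* (⇛-βc {M′ = M′} {V′ = V′} p v) =
    app-λ* (⇛⇒→βc* p) ◅◅ app-r* (ret-⇛ᵥ v) ◅◅ return (root (βc M′ V′))

  ret-⇛ᵥ : ∀ {V V′} → V ⇛ᵥ V′ → Star →βc (ret V) (ret V′)
  ret-⇛ᵥ ⇛-var     = ε
  ret-⇛ᵥ (⇛-lam p) = ret-λ* (⇛⇒→βc* p)

  app-⇛ᵥ : ∀ {V V′ L} → V ⇛ᵥ V′ → Star →βc (app V L) (app V′ L)
  app-⇛ᵥ ⇛-var     = ε
  app-⇛ᵥ (⇛-lam p) = app-λ* (⇛⇒→βc* p)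

confluent-βc : Confluent →βc
confluent-βc = triangle⇒confluent dev →βc⇒⇛ ⇛⇒→βc* dev-triangle

βc-substStable : SubstStable βc-root
βc-substStable s (βc M V) = subst (βc-root _) (sym (subC-[] s V M)) (βc (subC (exts s) M) (subV s V))

id-substStable : SubstStable id-root
id-substStable s (idr M) = idr (subC s M)

σ-substStable : SubstStable σ-root
σ-substStable s (σr N M L) =
  subst (σ-root _) (cong (λ N′ → app (lam (app (lam N′) (subC (exts s) M))) (subC s L)) (wk-subC s N))
        (σr (subC (exts s) N) (subC (exts s) M) (subC s L))

βc-after-σ : ∀ N M V → βc-root (app (lam (app (lam (wk N)) M)) (ret V)) (app (lam N) (M [ V ]))
βc-after-σ N M V =
  subst (βc-root _) (cong (λ N′ → app (lam N′) (M [ V ])) (subC-wk exts-sub0-wk N))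
        (βc (app (lam (wk N)) M) V)
  where
  exts-sub0-wk : exts (sub0 V) ∘ ext suc ≗ var
  exts-sub0-wk zero    = refl
  exts-sub0-wk (suc n) = refl

βc-wk-var : ∀ N → βc-root (app (lam (wk N)) (ret (var zero))) N
βc-wk-var N = subst (βc-root _) (subC-wk sub0-var-wk N) (βc (wk N) (var zero))
  where
  sub0-var-wk : sub0 (var zero) ∘ ext suc ≗ var
  sub0-var-wk zero    = refl
  sub0-var-wk (suc n) = refl

βc-root-vs-→id : Diagram βc-root →id →βc
βc-root-vs-→id (βc _ V) (root (idr _))    = -, ε , Refl.refl
βc-root-vs-→id (βc M _) (app-r (ret-λ y)) = -, []-↠ id-substStable (return y) M , Refl.[ root (βc M _) ]
βc-root-vs-→id (βc _ V) (app-λ y)         =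
  -, return (Ctx-subst id-substStable (sub0 V) y) , Refl.[ root (βc _ V) ]

→βc-vs-id-root : ∀ {M N₁ N₂} → →βc M N₁ → id-root M N₂ → ∃ λ P → Star →id N₁ P × ReflClosure →βc N₂ P
→βc-vs-id-root (root x)          y       = βc-root-vs-→id x (root y)
→βc-vs-id-root (app-r x)         (idr _) = -, return (root (idr _)) , Refl.[ x ]
→βc-vs-id-root (app-λ (root ())) (idr _)

βc-root-vs-→σ : Diagram βc-root →σ →βc
βc-root-vs-→σ (βc M _) (app-r (ret-λ y)) = -, []-↠ σ-substStable (return y) M , Refl.[ root (βc M _) ]
βc-root-vs-→σ (βc _ V) (app-λ y)         =
  -, return (Ctx-subst σ-substStable (sub0 V) y) , Refl.[ root (βc _ V) ]

→βc-vs-σ-root : ∀ {M N₁ N₂} → →βc M N₁ → σ-root M N₂ → ∃ λ P → Star →σ N₁ P × ReflClosure →βc N₂ P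
→βc-vs-σ-root (root (βc _ _)) ()
→βc-vs-σ-root (app-λ x) (σr _ M L) =
  -, return (root (σr _ M L)) , Refl.[ app-λ (app-λ (Ctx-rename βc-substStable (ext suc) x)) ]
→βc-vs-σ-root (app-r (root (βc M V))) (σr N _ _) = -, ε , Refl.[ root (βc-after-σ N M V) ]
→βc-vs-σ-root (app-r (app-λ x)) (σr N _ L) = -, return (root (σr N _ L)) , Refl.[ app-λ (app-r x) ]
→βc-vs-σ-root (app-r (app-r x)) (σr N M L) = -, return (root (σr N M _)) , Refl.[ app-r x ]

id-root-vs-→σ : Diagram id-root →σ (Ctx (βc-root ∪ id-root))
id-root-vs-→σ (idr _) (root (σr _ M L)) = -, ε , Refl.[ app-λ (root (inj₂ (idr M))) ]
id-root-vs-→σ (idr _) (app-r y)         = -, return y , Refl.[ root (inj₂ (idr _)) ]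
id-root-vs-→σ (idr _) (app-λ (root ()))

→id-vs-σ-root : ∀ {M N₁ N₂} → →id M N₁ → σ-root M N₂ →
                ∃ λ P → Star →σ N₁ P × ReflClosure (Ctx (βc-root ∪ id-root)) N₂ P
→id-vs-σ-root (root x) y = id-root-vs-→σ x (root y)
→id-vs-σ-root (app-λ x) (σr _ M L) =
  -, return (root (σr _ M L)) , Refl.[ app-λ (app-λ (Ctx-map inj₂ (Ctx-rename id-substStable (ext suc) x))) ]
→id-vs-σ-root (app-r (root (idr _))) (σr N _ _) = -, ε , Refl.[ app-λ (root (inj₁ (βc-wk-var N))) ]
→id-vs-σ-root (app-r (app-λ x)) (σr N _ L) =
  -, return (root (σr N _ L)) , Refl.[ app-λ (app-r (Ctx-map inj₂ x)) ]
→id-vs-σ-root (app-r (app-r x)) (σr N M L) = -, return (root (σr N M _)) , Refl.[ app-r (Ctx-map inj₂ x) ]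

strongly-commute-βc-id : StronglyCommute →βc →id
strongly-commute-βc-id = Ctx-diagram id βc-root-vs-→id →βc-vs-id-root

strongly-commute-βc-σ : StronglyCommute →βc →σ
strongly-commute-βc-σ = Ctx-diagram id βc-root-vs-→σ →βc-vs-σ-root

strongly-commute-βc∪id-σ : StronglyCommute (→βc ∪ →id) →σ
strongly-commute-βc∪id-σ =
  Diagram-∪ (Diagram-weaken inj₁ strongly-commute-βc-σ)
            (Diagram-weaken Ctx-∪ (Ctx-diagram inj₂ id-root-vs-→σ →id-vs-σ-root))

confluent-βc∪id : Confluent (→βc ∪→ →id)
confluent-βc∪id = hindley-rosen confluent-βc confluent-id (strongly-commute⇒commute strongly-commute-βc-id)

confluent-βc∪σ : Confluent (→βc ∪→ →σ)
confluent-βc∪σ = hindley-rosen confluent-βc confluent-σ (strongly-commute⇒commute strongly-commute-βc-σ)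

confluent-βc∪σ∪id : Confluent ((→βc ∪→ →σ) ∪→ →id)
confluent-βc∪σ∪id =
  confluent-transfer (return ∘ ∪-swapʳ {R = →βc} {S = →σ} {T = →id})
                     (return ∘ ∪-swapʳ {R = →βc} {S = →id} {T = →σ})
                     (hindley-rosen confluent-βc∪id confluent-σ
                                    (strongly-commute⇒commute strongly-commute-βc∪id-σ))

-- (λy.!z)((λx.!x)!z), its id-reduct (λy.!z)!z and its σ-reduct (λx.(λy.!z)!x)!z
id-σ-peak id-reduct σ-reduct : Comp
id-σ-peak = app (lam (ret (var 1))) (app (lam (ret (var 0))) (ret (var 0)))
id-reduct = app (lam (ret (var 1))) (ret (var 0))
σ-reduct  = app (lam (app (lam (ret (var 2))) (ret (var 0)))) (ret (var 0))

id-reduct-normal : Rewriting.IsNormalForm (→σ ∪→ →id) id-reduct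
id-reduct-normal (_ , inj₁ (root ()))
id-reduct-normal (_ , inj₁ (app-r (root ())))
id-reduct-normal (_ , inj₁ (app-λ (root ())))
id-reduct-normal (_ , inj₂ (root ()))
id-reduct-normal (_ , inj₂ (app-r (root ())))
id-reduct-normal (_ , inj₂ (app-λ (root ())))

σ-reduct-normal : Rewriting.IsNormalForm (→σ ∪→ →id) σ-reduct
σ-reduct-normal (_ , inj₁ (root ()))
σ-reduct-normal (_ , inj₁ (app-r (root ())))
σ-reduct-normal (_ , inj₁ (app-λ (root ())))
σ-reduct-normal (_ , inj₁ (app-λ (app-r (root ()))))
σ-reduct-normal (_ , inj₁ (app-λ (app-λ (root ()))))
σ-reduct-normal (_ , inj₂ (root ()))
σ-reduct-normal (_ , inj₂ (app-r (root ())))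
σ-reduct-normal (_ , inj₂ (app-λ (root ())))
σ-reduct-normal (_ , inj₂ (app-λ (app-r (root ()))))
σ-reduct-normal (_ , inj₂ (app-λ (app-λ (root ()))))

peak⟶id-reduct : (→σ ∪→ →id) id-σ-peak id-reduct
peak⟶id-reduct = inj₂ (app-r (root (idr _)))

peak⟶σ-reduct : (→σ ∪→ →id) id-σ-peak σ-reduct
peak⟶σ-reduct = inj₁ (root (σr _ _ _))

¬confluent-σ∪id : ¬ Confluent (→σ ∪→ →id)
¬confluent-σ∪id conf with Rewriting.conf⇒unf conf id-reduct-normal σ-reduct-normal
  (a—↠b&a—↠c⇒b↔c (return peak⟶id-reduct) (return peak⟶σ-reduct))
... | ()

mainTheorem10 : (Confluent →βc × Confluent →id × Confluent →σ)
    × (Confluent (→βc ∪→ →id) × Confluent (→βc ∪→ →σ))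
    × Confluent ((→βc ∪→ →σ) ∪→ →id)
    × ¬ Confluent (→σ ∪→ →id)
mainTheorem10 =
  (confluent-βc , confluent-id , confluent-σ) ,
  (confluent-βc∪id , confluent-βc∪σ) ,
  confluent-βc∪σ∪id ,
  ¬confluent-σ∪id
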